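{- For every wff $\mathbf{A}_\alpha$ of $\mathcal{Q}^{\rm u}_{0}$: if $\vdash\mathbf{A}_\alpha\downarrow$, then $\vdash\mathbf{A}_\alpha=\mathbf{A}_\alpha$.
   Context: SYNTAX. Type symbols: $\imath$, $o$, and $(\alpha\beta)$ for types $\alpha,\beta$ (functions from $\beta$ to $\alpha$). Primitive symbols: $[$, $]$, $\lambda$; denumerably many variables of each type; logical constants $\mathrm{Q}_{o\alpha\alpha}$ (every $\alpha$) and $\iota_{\alpha(o\alpha)}$ ($\alpha\neq o$); nonlogical constants of various types. Wffs: variables and primitive constants of type $\alpha$; $[\mathbf{A}_{\alpha\beta}\mathbf{B}_\beta]$ of type $\alpha$; $[\lambda\mathbf{x}_\beta\mathbf{A}_\alpha]$ of type $\alpha\beta$. $\mathrm{S}^{\mathbf{x}_\alpha}_{\mathbf{A}_\alpha}\mathbf{B}$ is substitution for free occurrences. ABBREVIATIONS. $[\mathbf{A}_\alpha=\mathbf{B}_\alpha]$ is $[\mathrm{Q}_{o\alpha\alpha}\mathbf{A}_\alpha\mathbf{B}_\alpha]$; $T_o$ is $[\mathrm{Q}_{ooo}=\mathrm{Q}_{ooo}]$; $F_o$ is $[[\lambda x_o T_o]=[\lambda x_o x_o]]$; $[\forall\mathbf{x}_\alpha\mathbf{A}_o]$ is $[[\lambda y_\alpha T_o]=[\lambda\mathbf{x}_\alpha\mathbf{A}_o]]$; $[\mathbf{A}_o\wedge\mathbf{B}_o]$ is $[[\lambda x_o\lambda y_o[[\lambda g_{ooo}[g_{ooo}T_oT_o]]=[\lambda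 g_{ooo}[g_{ooo}x_oy_o]]]]\mathbf{A}_o\mathbf{B}_o]$; $[\mathbf{A}_o\supset\mathbf{B}_o]$ is $[[\lambda x_o\lambda y_o[x_o=[x_o\wedge y_o]]]\mathbf{A}_o\mathbf{B}_o]$; $[\sim\mathbf{A}_o]$ is $[\mathrm{Q}_{ooo}F_o\mathbf{A}_o]$; $[\mathbf{A}_o\vee\mathbf{B}_o]$ is $[[\lambda x_o\lambda y_o[\sim[[\sim x_o]\wedge[\sim y_o]]]]\mathbf{A}_o\mathbf{B}_o]$; $[\exists\mathbf{x}_\alpha\mathbf{A}_o]$ is $[\sim[\forall\mathbf{x}_\alpha\sim\mathbf{A}_o]]$; $[\exists_1\mathbf{x}_\alpha\mathbf{A}_o]$ is $[\exists y_\alpha[[\lambda\mathbf{x}_\alpha\mathbf{A}_o]=\mathrm{Q}_{o\alpha\alpha}y_\alpha]]$; $[\mathbf{A}_\alpha\downarrow]$ is $[\exists x_\alpha[x_\alpha=\mathbf{A}_\alpha]]$ ($x_\alpha$ not in $\mathbf{A}_\alpha$); $[\mathbf{A}_\alpha\uparrow]$ is $[\sim[\mathbf{A}_\alpha\downarrow]]$; $[\mathbf{A}_\alpha\simeq\mathbf{B}_\alpha]$ is $[[\mathbf{A}_\alpha\downarrow\vee\mathbf{B}_\alpha\downarrow]\supset[\mathbf{A}_\alpha=\mathbf{B}_\alpha]]$; $[\mathrm{I}\mathbf{x}_\alpha\mathbf{A}_o]$ is $[\iota_{\alpha(o\alpha)}[\lambda\mathbf{x}_\alpha\mathbf{A}_o]]$.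 PROOF SYSTEM. Axiom schemas A1 $[g_{oo}T_o\wedge g_{oo}F_o]=\forall x_o[g_{oo}x_o]$; A2 $[x_\alpha=y_\alpha]\supset[h_{o\alpha}x_\alpha=h_{o\alpha}y_\alpha]$; A3 $[f_{\alpha\beta}=g_{\alpha\beta}]=\forall x_\beta[f_{\alpha\beta}x_\beta\simeq g_{\alpha\beta}x_\beta]$; A4 $\mathbf{A}_\alpha\downarrow\supset[[\lambda\mathbf{x}_\alpha\mathbf{B}_\beta]\mathbf{A}_\alpha\simeq\mathrm{S}^{\mathbf{x}_\alpha}_{\mathbf{A}_\alpha}\mathbf{B}_\beta]$ ($\mathbf{A}_\alpha$ free for $\mathbf{x}_\alpha$ in $\mathbf{B}_\beta$); A5 $\mathbf{x}_\alpha\downarrow$; A6 $\mathbf{c}_\alpha\downarrow$ ($\mathbf{c}_\alpha$ primitive constant); A7 $[\lambda\mathbf{x}_\alpha\mathbf{B}_\beta]\downarrow$; A8 $\mathbf{A}_{o\beta}\mathbf{B}_\beta\downarrow$; A9 $[\mathbf{A}_{o\beta}\uparrow\vee\mathbf{B}_\beta\uparrow]\supset\sim[\mathbf{A}_{o\beta}\mathbf{B}_\beta]$; A10 $[\mathbf{A}_{\alpha\beta}\uparrow\vee\mathbf{B}_\beta\uparrow]\supset[\mathbf{A}_{\alpha\beta}\mathbf{B}_\beta]\uparrow$ ($\alpha\neq o$); A11 $\mathbf{A}_\alpha\downarrow\supset[\mathbf{B}_\alpha\downarrow\supset[[\mathbf{A}_\alpha\simeq\mathbf{B}_\alpha]\simeq[\mathbf{A}_\alpha=\mathbf{B}_\alpha]]]$;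 A12 $\exists_1\mathbf{x}_\alpha\mathbf{A}_o\supset[[\mathrm{I}\mathbf{x}_\alpha\mathbf{A}_o]\downarrow\wedge\mathrm{S}^{\mathbf{x}_\alpha}_{[\mathrm{I}\mathbf{x}_\alpha\mathbf{A}_o]}\mathbf{A}_o]$ ($\alpha\neq o$, $\mathrm{I}\mathbf{x}_\alpha\mathbf{A}_o$ free for $\mathbf{x}_\alpha$ in $\mathbf{A}_o$); A13 $\sim[\exists_1\mathbf{x}_\alpha\mathbf{A}_o]\supset[\mathrm{I}\mathbf{x}_\alpha\mathbf{A}_o]\uparrow$ ($\alpha\neq o$). Rules: R1 from $\mathbf{A}_\alpha\simeq\mathbf{B}_\alpha$ and $\mathbf{C}_o$ infer $\mathbf{C}_o$ with one occurrence of $\mathbf{A}_\alpha$ (not an occurrence of a variable immediately preceded by $\lambda$) replaced by $\mathbf{B}_\alpha$; R2 from $\mathbf{A}_o$ and $\mathbf{A}_o\supset\mathbf{B}_o$ infer $\mathbf{B}_o$. A proof is a finite sequence of wffs$_o$ each an axiom instance or obtained from earlier members by R1 or R2; $\vdash\mathbf{A}_o$ means $\mathbf{A}_o$ has a proof. -}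

module Defs where

open import Data.Nat using (ℕ; zero; suc; _⊔_)
open import Data.Bool using (Bool; true; false; _∧_; _∨_; not; if_then_else_)
open import Data.Unit using (⊤; tt)
open import Data.Empty using (⊥)
open import Data.Product using (_×_)
open import Relation.Nullary using (Dec; yes; no)
open import Relation.Binary.PropositionalEquality using (_≡_; refl)
import Data.Nat as N

-- Types of Q^u_0.  fn α β is the paper's (αβ): functions from β to α.

data Ty : Set where
  ι  : Ty
  o  : Ty
  fn : Ty → Ty → Ty

_≟T_ : (α β : Ty) → Dec (α ≡ β)
ι ≟T ι = yes refl
ι ≟T o = no (λ ())
ι ≟T fn _ _ = no (λ ())
o ≟T ι = no (λ ())
o ≟T o = yes refl
o ≟T fn _ _ = no (λ ())
fn _ _ ≟T ι = no (λ ())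
fn _ _ ≟T o = no (λ ())
fn α β ≟T fn γ δ with α ≟T γ | β ≟T δ
... | yes refl | yes refl = yes refl
... | no p | _ = no (λ { refl → p refl })
... | yes _ | no q = no (λ { refl → q refl })

eqTy : Ty → Ty → Bool
eqTy α β with α ≟T β
... | yes _ = true
... | no _ = false

NotO : Ty → Set
NotO ι = ⊤
NotO o = ⊥
NotO (fn _ _) = ⊤

-- Syntax, parameterised by the nonlogical constants C α of each type α.
-- A variable x_α is a name n : ℕ together with its type α
-- (denumerably many variables of each type).

module Syntax (C : Ty → Set) where

  data Wff : Ty → Set where
    var  : ∀ {α} → ℕ → Wff α
    Q    : (α : Ty) → Wff (fn (fn o α) α)
    iota : (α : Ty) → NotO α → Wff (fn α (fn o α))
    con  : ∀ {α} → C α → Wff α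
    app  : ∀ {α β} → Wff (fn α β) → Wff β → Wff α
    lam  : ∀ {α} → ℕ → (β : Ty) → Wff α → Wff (fn α β)

  data PrimConst : ∀ {α} → Wff α → Set where
    pcQ    : ∀ α → PrimConst (Q α)
    pcIota : ∀ α (p : NotO α) → PrimConst (iota α p)
    pcCon  : ∀ {α} (c : C α) → PrimConst (con c)

  sameVar : ℕ → Ty → ℕ → Ty → Bool
  sameVar n α m β = (n N.≡ᵇ m) ∧ eqTy α β

  occursFree : ℕ → Ty → ∀ {β} → Wff β → Bool
  occursFree n α (var {β} m) = sameVar n α m β
  occursFree n α (Q _) = false
  occursFree n α (iota _ _) = false
  occursFree n α (con _) = false
  occursFree n α (app F X) = occursFree n α F ∨ occursFree n α X
  occursFree n α (lam m β B) = not (sameVar n α m β) ∧ occursFree n α B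

  maxName : ∀ {β} → Wff β → ℕ
  maxName (var m) = m
  maxName (Q _) = 0
  maxName (iota _ _) = 0
  maxName (con _) = 0
  maxName (app F X) = maxName F ⊔ maxName X
  maxName (lam m _ B) = m ⊔ maxName B

  S : ∀ {α} → ℕ → Wff α → ∀ {β} → Wff β → Wff β
  S {α} n A (var {β} m) with n N.≡ᵇ m | β ≟T α
  ... | true | yes refl = A
  ... | _ | _ = var m
  S n A (Q γ) = Q γ
  S n A (iota γ p) = iota γ p
  S n A (con c) = con c
  S n A (app F X) = app (S n A F) (S n A X)
  S {α} n A (lam m β B) =
    if sameVar n α m β then lam m β B else lam m β (S n A B)

  FreeFor : ∀ {α} → Wff α → ℕ → ∀ {β} → Wff β → Set
  FreeFor A n (var _) = ⊤
  FreeFor A n (Q _) = ⊤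
  FreeFor A n (iota _ _) = ⊤
  FreeFor A n (con _) = ⊤
  FreeFor A n (app F X) = FreeFor A n F × FreeFor A n X
  FreeFor {α} A n (lam m β B) with sameVar n α m β
  ... | true = ⊤
  ... | false =
    ((occursFree n α B ≡ true) → (occursFree m β A ≡ false)) × FreeFor A n B

  vx vy vg vh vf : ℕ
  vx = 0
  vy = 1
  vg = 2
  vh = 3
  vf = 4

  infix 4 _==_
  _==_ : ∀ {α} → Wff α → Wff α → Wff o
  _==_ {α} A B = app (app (Q α) A) B

  T : Wff o
  T = Q (fn (fn o o) o) == Q (fn (fn o o) o)

  F : Wff o
  F = lam vx o T == lam vx o (var {o} vx)

  Forall : ℕ → (α : Ty) → Wff o → Wff o
  Forall n α A = lam vy α T == lam n α A

  _&_ : Wff o → Wff o → Wff o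
  A & B = app (app (lam vx o (lam vy o
            (lam vg (fn (fn o o) o) (app (app (var {fn (fn o o) o} vg) T) T)
              == lam vg (fn (fn o o) o) (app (app (var {fn (fn o o) o} vg) (var {o} vx)) (var {o} vy)))))
            A) B

  _⊃_ : Wff o → Wff o → Wff o
  A ⊃ B = app (app (lam vx o (lam vy o (var {o} vx == (var vx & var vy)))) A) B

  ∼ : Wff o → Wff o
  ∼ A = app (app (Q o) F) A

  _or_ : Wff o → Wff o → Wff o
  A or B = app (app (lam vx o (lam vy o (∼ (∼ (var {o} vx) & ∼ (var {o} vy))))) A) B

  Exists : ℕ → (α : Ty) → Wff o → Wff o
  Exists n α A = ∼ (Forall n α (∼ A))

  -- ∃₁ x_α A : ∃ y_α [[λ x_α A] = Q_{oαα} y_α], y chosen not occurring in A, x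
  Exists1 : ℕ → (α : Ty) → Wff o → Wff o
  Exists1 n α A = Exists y α (lam n α A == app (Q α) (var y))
    where y = suc (n ⊔ maxName A)

  -- A_α ↓ : ∃ x_α [x_α = A_α], x_α not occurring in A
  _↓ : ∀ {α} → Wff α → Wff o
  _↓ {α} A = Exists z α (var {α} z == A)
    where z = suc (maxName A)

  _↑ : ∀ {α} → Wff α → Wff o
  A ↑ = ∼ (A ↓)

  _≃_ : ∀ {α} → Wff α → Wff α → Wff o
  A ≃ B = ((A ↓) or (B ↓)) ⊃ (A == B)

  Iota : ℕ → (α : Ty) → NotO α → Wff o → Wff α
  Iota n α p A = app (iota α p) (lam n α A)

  data Axiom : Wff o → Set where
    A1  : Axiom ((app (var {fn o o} vg) T & app (var vg) F)
                   == Forall vx o (app (var {fn o o} vg) (var vx)))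
    A2  : ∀ α → Axiom ((var {α} vx == var vy)
                   ⊃ (app (var {fn o α} vh) (var vx) == app (var {fn o α} vh) (var vy)))
    A3  : ∀ α β → Axiom ((var {fn α β} vf == var vg)
                   == Forall vx β (app (var {fn α β} vf) (var vx)
                                    ≃ app (var {fn α β} vg) (var vx)))
    A4  : ∀ {α β} (n : ℕ) (A : Wff α) (B : Wff β) → FreeFor A n B →
          Axiom ((A ↓) ⊃ (app (lam n α B) A ≃ S n A B))
    A5  : ∀ {α} (n : ℕ) → Axiom (var {α} n ↓)
    A6  : ∀ {α} (c : Wff α) → PrimConst c → Axiom (c ↓)
    A7  : ∀ {α} (n : ℕ) (β : Ty) (B : Wff α) → Axiom (lam n β B ↓)
    A8  : ∀ {β} (A : Wff (fn o β)) (B : Wff β) → Axiom (app A B ↓)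
    A9  : ∀ {β} (A : Wff (fn o β)) (B : Wff β) →
          Axiom (((A ↑) or (B ↑)) ⊃ ∼ (app A B))
    A10 : ∀ {α β} → NotO α → (A : Wff (fn α β)) (B : Wff β) →
          Axiom (((A ↑) or (B ↑)) ⊃ (app A B ↑))
    A11 : ∀ {α} (A B : Wff α) →
          Axiom ((A ↓) ⊃ ((B ↓) ⊃ ((A ≃ B) ≃ (A == B))))
    A12 : ∀ (n : ℕ) (α : Ty) (p : NotO α) (A : Wff o) →
          FreeFor (Iota n α p A) n A →
          Axiom (Exists1 n α A ⊃ ((Iota n α p A ↓) & S n (Iota n α p A) A))
    A13 : ∀ (n : ℕ) (α : Ty) (p : NotO α) (A : Wff o) →
          Axiom (∼ (Exists1 n α A) ⊃ (Iota n α p A ↑))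

  data Replace {α} (A B : Wff α) : ∀ {γ} → Wff γ → Wff γ → Set where
    here : Replace A B A B
    appL : ∀ {γ δ} {G G' : Wff (fn γ δ)} {X : Wff δ} →
           Replace A B G G' → Replace A B (app G X) (app G' X)
    appR : ∀ {γ δ} {G : Wff (fn γ δ)} {X X' : Wff δ} →
           Replace A B X X' → Replace A B (app G X) (app G X')
    lamB : ∀ {γ} {n : ℕ} {β : Ty} {D D' : Wff γ} →
           Replace A B D D' → Replace A B (lam n β D) (lam n β D')

  infix 2 ⊢_
  data ⊢_ : Wff o → Set where
    ax : ∀ {P} → Axiom P → ⊢ P
    R1 : ∀ {α} {A B : Wff α} {P P' : Wff o} →
         ⊢ (A ≃ B) → ⊢ P → Replace A B P P' → ⊢ P'
    R2 : ∀ {P R : Wff o} → ⊢ P → ⊢ (P ⊃ R) → ⊢ R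

-- A4 instantiated with the identity redex [λx x]A gives [λx x]A ≃ A.  Using
-- this theorem with R1 to rewrite both occurrences of the redex inside itself
-- yields A ≃ A, and A11 turns ≃ into = between defined wffs.
module Submission where

open import Data.Bool using (true)
open import Data.Empty using (⊥-elim)
open import Data.Nat using (ℕ; _≡ᵇ_)
open import Data.Nat.Properties using (≡⇒≡ᵇ)
open import Data.Unit using (tt)
open import Relation.Nullary using (yes; no)
open import Relation.Binary.PropositionalEquality using (_≡_; refl; subst)

open import Defs

module Derivations (C : Ty → Set) where
  open Syntax C

  S-var-self : ∀ {α} (n : ℕ) (A : Wff α) → S n A (var {α} n) ≡ A
  S-var-self {α} n A with n ≡ᵇ n | ≡⇒≡ᵇ n n refl | α ≟T α
  ... | true | _ | yes refl = refl
  ... | true | _ | no α≢α = ⊥-elim (α≢α refl)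

  β-identity : ∀ {α} (n : ℕ) {A : Wff α} → ⊢ (A ↓) → ⊢ (app (lam n α (var n)) A ≃ A)
  β-identity n {A} A↓ =
    subst (λ B → ⊢ (_ ≃ B)) (S-var-self n A) (R2 A↓ (ax (A4 n A (var n) tt)))

  ≃-refl : ∀ {α} {A : Wff α} → ⊢ (A ↓) → ⊢ (A ≃ A)
  ≃-refl {α} {A} A↓ = R1 L≃A (R1 L≃A L≃A redex-in-equation) redex-in-antecedent
    where
    -- Binding x_0 keeps maxName L = maxName A, so L ↓ and A ↓ share their
    -- bound variable and the second rewrite really produces A ↓.
    L : Wff α
    L = app (lam 0 α (var 0)) A

    L≃A : ⊢ (L ≃ A)
    L≃A = β-identity 0 A↓

    redex-in-equation : Replace L A (L ≃ A) (((L ↓) or (A ↓)) ⊃ (A == A))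
    redex-in-equation = appR (appL (appR here))

    redex-in-antecedent : Replace L A (((L ↓) or (A ↓)) ⊃ (A == A)) (A ≃ A)
    redex-in-antecedent = appL (appR (appL (appR (appR (appR (lamB (appR (appR here))))))))

  ≃⇒== : ∀ {α} {A B : Wff α} → ⊢ (A ↓) → ⊢ (B ↓) → ⊢ (A ≃ B) → ⊢ (A == B)
  ≃⇒== {A = A} {B} A↓ B↓ A≃B = R1 (R2 B↓ (R2 A↓ (ax (A11 A B)))) A≃B here

corollary1 : (C : Ty → Set) → let open Syntax C in
    ∀ {α} (A : Wff α) → ⊢ (A ↓) → ⊢ (A == A)
corollary1 C A A↓ = ≃⇒== A↓ A↓ (≃-refl A↓)
  where open Derivations C
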